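{- Let $n\geq 3$ and consider the run, for this $n$, of the following recursive search procedure started from $(p,s,i)=(1,0,0)$ and the empty candidate. The procedure, called with $(p,s,i)$ and candidate $(a_1,\dots,a_i)$, lets $m:=a_i$ if $i\geq1$ and $m:=n$ if $i=0$; for each $a'=2,\dots,m$ it sets $a_{i+1}:=a'$, $s':=s+a'$, $p':=pa'$, $i':=i+1$, and: if $p'>s'+n-i'$ it discards $a'$; if $p'=s'+n-i'$ it records $(a_1,\dots,a_{i'},1,\dots,1)\in\mathbb N^n$ as a solution; if $p'<s'+n-i'$ it calls itself recursively with $(p',s',i')$ and candidate $(a_1,\dots,a_{i'})$. Call a step of this run at which $p'<s'+n-i'$ a feasible step. Then: (1) At every feasible step, with $n':=p'-s'+i'$, one has $i'\leq n'<n$, and the sequence $\widetilde a=(a_1,\dots,a_i,a',1,\dots,1)\in\mathbb N^{n'}$ satisfies $\prod_{j=1}^{n'}\widetilde a_j=\sum_{j=1}^{n'}\widetilde a_j$. (2) For every $n'<n$, every non-increasing positive integer solution of $\prod_{j=1}^{n'} a_j=\sum_{j=1}^{n'} a_j$ arises in this way from some feasible step of the run. (3) No solution arises from two different feasible steps; that is, the correspondence in (1) is injective.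
   Context: All sequences are of positive integers and non-increasing. $\mathbb N$ denotes the positive integers. -}

module Defs where

open import Data.Nat using (ℕ; zero; suc; _+_; _*_; _∸_; _<ᵇ_)
open import Data.Bool using (if_then_else_)
open import Data.List using (List; []; _∷_; _++_; [_]; concatMap; applyUpTo; replicate)

-- A feasible step of the run: the extended candidate (a_1,…,a_i,a'),
-- together with p' , s' , i'.
record Step : Set where
  constructor step
  field
    cand : List ℕ
    p'   : ℕ
    s'   : ℕ
    i'   : ℕ

open Step public

range2 : ℕ → List ℕ
range2 m = applyUpTo (λ k → 2 + k) (m ∸ 1)

-- The search procedure, called with (p,s,i), candidate c = (a_1,…,a_i) and
-- m (= a_i if i ≥ 1, = n if i = 0).  It returns, in order of occurrence,
-- the list of all feasible steps (p' < s' + n - i') performed in this call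
-- and in its recursive sub-calls.  Steps with p' > s'+n-i' (discard) and
-- p' = s'+n-i' (record a solution) produce no feasible step and no
-- recursive call.  The first ℕ argument after n is fuel (recursion depth
-- bound); the run uses fuel n, which is never exhausted since feasible
-- steps have i' ≤ n' < n.
search : (n fuel p s i : ℕ) → List ℕ → ℕ → List Step
search n zero p s i c m = []
search n (suc f) p s i c m = concatMap branch (range2 m)
  where
  branch : ℕ → List Step
  branch a =
    if (p * a) <ᵇ ((s + a + n) ∸ suc i)
    then step (c ++ [ a ]) (p * a) (s + a) (suc i)
           ∷ search n f (p * a) (s + a) (suc i) (c ++ [ a ]) a
    else []

feasibleSteps : ℕ → List Step
feasibleSteps n = search n n 1 0 0 [] n

-- n' := p' - s' + i'  (natural subtraction; part (1) asserts it is genuine)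
n'Of : Step → ℕ
n'Of st = (p' st + i' st) ∸ s' st

solOf : Step → List ℕ
solOf st = cand st ++ replicate (n'Of st ∸ i' st) 1

-- Every call of the search is made with (p, s, i) the product, sum and length of its candidate c, whose
-- entries are at least 2 and non-increasing.  For such c we have sum c ≤ product c, so a feasible step
-- (product c + length c < sum c + n) yields n' = product c - sum c + length c < n, and padding c with
-- product c - sum c ones gives a product-sum solution of length n'.  Conversely, a non-increasing solution
-- is b followed by r ones with all entries of b at least 2; its first entry is at most n' < n, and
-- feasibility passes from b to its prefixes, because appending entries ≥ 2 to a list of product ≥ 2 raises
-- the product at least as much as the sum, so the search walks down b.  Two feasible steps have different
-- candidates (either the branches they lie in split at some position, or one candidate is a proper prefix
-- of the other), and the candidate is recovered from the solution by dropping the trailing ones.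

module Submission where

open import Defs
open import Data.Nat using (ℕ; _≤_; _<_; _≥_; _+_; _∸_)
open import Data.Nat.ListAction using (sum; product)
open import Data.Product using (_×_; ∃; Σ)
open import Data.List using (List; length; map; _++_; replicate)
open import Data.List.Membership.Propositional using (_∈_)
open import Data.List.Relation.Unary.All using (All)
open import Data.List.Relation.Unary.Linked using (Linked)
open import Data.List.Relation.Unary.Unique.Propositional using (Unique)
open import Relation.Binary.PropositionalEquality using (_≡_)

open import Data.Bool using (true; false; T; if_then_else_)
open import Data.Empty using (⊥-elim)
open import Data.List using ([]; _∷_; [_]; concatMap)
open import Data.List.Properties
  using (++-assoc; ++-identityʳ-unique; ++-cancelˡ; ∷-injectiveˡ; length-++; length-replicate; map-∘; map-cong-local)
open import Data.List.Membership.Propositional using (lose)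
open import Data.List.Membership.Propositional.Properties using (∈-applyUpTo⁺; ∈-applyUpTo⁻; ∈-concatMap⁺)
open import Data.List.Relation.Unary.All using ([]; _∷_)
import Data.List.Relation.Unary.All as All
import Data.List.Relation.Unary.All.Properties as Allₚ
open import Data.List.Relation.Unary.Any using (here; there)
open import Data.List.Relation.Unary.AllPairs using (AllPairs; []; _∷_)
import Data.List.Relation.Unary.AllPairs as AllPairs
import Data.List.Relation.Unary.AllPairs.Properties as AllPairsₚ
open import Data.List.Relation.Unary.Linked using ([]; [-]; _∷_)
import Data.List.Relation.Unary.Linked as Linked
import Data.List.Relation.Unary.Unique.Propositional.Properties as Uniqueₚ
open import Data.Nat using (zero; suc; _*_; _^_; _<ᵇ_; z≤n; s≤s; s≤s⁻¹)
open import Data.Nat.ListAction.Properties using (sum-++; product-++)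
open import Data.Nat.Properties
open import Data.Nat.Tactic.RingSolver using (solve-∀)
open import Data.Product using (_,_; ∃₂)
open import Function.Base using (_on_; _∘′_)
open import Function.Bundles using (_⇔_; mk⇔; Equivalence)
open import Algebra.Properties.CommutativeSemigroup +-commutativeSemigroup using (xy∙z≈xz∙y)
open import Relation.Binary.PropositionalEquality using (refl; sym; trans; cong; cong₂; subst; subst₂; _≢_; module ≡-Reasoning)
open import Relation.Nullary using (¬_)

variable
  n p s i m x : ℕ
  c d : List ℕ

m<o∸n⇔m+n<o : ∀ m n o → m < o ∸ n ⇔ m + n < o
m<o∸n⇔m+n<o m n o = mk⇔ to (m+n≤o⇒m≤o∸n (suc m))
  where
  to : m < o ∸ n → m + n < o
  to m<o∸n = m≤o∸n⇒m+n≤o (suc m) (<⇒≤ n<o) m<o∸n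
    where
    n<o : n < o
    n<o = m∸n≢0⇒n<m (λ o∸n≡0 → n≮0 (subst (m <_) o∸n≡0 m<o∸n))

m+n≤m*n : 2 ≤ m → 2 ≤ n → m + n ≤ m * n
m+n≤m*n {suc (suc a)} {suc (suc b)} (s≤s (s≤s _)) (s≤s (s≤s _)) =
  subst ((2 + a) + (2 + b) ≤_) (expand a b) (m≤m+n ((2 + a) + (2 + b)) (a * b + a + b))
  where
  expand : ∀ a b → (2 + a) + (2 + b) + (a * b + a + b) ≡ (2 + a) * (2 + b)
  expand = solve-∀

m+m+n≤m*n+2 : 1 ≤ m → 2 ≤ n → m + m + n ≤ m * n + 2
m+m+n≤m*n+2 {suc a} {suc (suc b)} (s≤s _) (s≤s (s≤s _)) =
  subst ((1 + a) + (1 + a) + (2 + b) ≤_) (expand a b) (m≤m+n ((1 + a) + (1 + a) + (2 + b)) (a * b))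
  where
  expand : ∀ a b → (1 + a) + (1 + a) + (2 + b) + a * b ≡ (1 + a) * (2 + b) + 2
  expand = solve-∀

sum-replicate : ∀ k x → sum (replicate k x) ≡ k * x
sum-replicate zero    x = refl
sum-replicate (suc k) x = cong (x +_) (sum-replicate k x)

product-replicate : ∀ k x → product (replicate k x) ≡ x ^ k
product-replicate zero    x = refl
product-replicate (suc k) x = cong (x *_) (product-replicate k x)

sum-++-ones : ∀ c k → sum (c ++ replicate k 1) ≡ sum c + k
sum-++-ones c k = begin
  sum (c ++ replicate k 1)        ≡⟨ sum-++ c (replicate k 1) ⟩
  sum c + sum (replicate k 1)     ≡⟨ cong (sum c +_) (sum-replicate k 1) ⟩
  sum c + k * 1                   ≡⟨ cong (sum c +_) (*-identityʳ k) ⟩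
  sum c + k                       ∎
  where open ≡-Reasoning

product-++-ones : ∀ c k → product (c ++ replicate k 1) ≡ product c
product-++-ones c k = begin
  product (c ++ replicate k 1)          ≡⟨ product-++ c (replicate k 1) ⟩
  product c * product (replicate k 1)   ≡⟨ cong (product c *_) (product-replicate k 1) ⟩
  product c * 1 ^ k                     ≡⟨ cong (product c *_) (^-zeroˡ k) ⟩
  product c * 1                         ≡⟨ *-identityʳ (product c) ⟩
  product c                             ∎
  where open ≡-Reasoning

sum-∷ʳ : ∀ c x → sum (c ++ [ x ]) ≡ sum c + x
sum-∷ʳ c x = trans (sum-++ c [ x ]) (cong (sum c +_) (+-identityʳ x))

product-∷ʳ : ∀ c x → product (c ++ [ x ]) ≡ product c * x
product-∷ʳ c x = trans (product-++ c [ x ]) (cong (product c *_) (*-identityʳ x))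

+-sum≤*-product : 2 ≤ m → All (2 ≤_) d → m + sum d ≤ m * product d
+-sum≤*-product {m} {[]} _ [] = ≤-reflexive (trans (+-identityʳ m) (sym (*-identityʳ m)))
+-sum≤*-product {m} {x ∷ d} 2≤m (2≤x ∷ d≥2) = begin
  m + (x + sum d)       ≤⟨ +-monoʳ-≤ m x+Σ≤x*Π ⟩
  m + x * product d     ≤⟨ m+n≤m*n 2≤m (≤-trans 2≤x (≤-trans (m≤m+n x (sum d)) x+Σ≤x*Π)) ⟩
  m * (x * product d)   ∎
  where
  open ≤-Reasoning
  x+Σ≤x*Π : x + sum d ≤ x * product d
  x+Σ≤x*Π = +-sum≤*-product 2≤x d≥2

sum≤product : All (2 ≤_) d → sum d ≤ product d
sum≤product []          = z≤n
sum≤product (2≤x ∷ d≥2) = +-sum≤*-product 2≤x d≥2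

padOnes : List ℕ → List ℕ
padOnes c = c ++ replicate (product c ∸ sum c) 1

padOnes-isProductSum : sum c ≤ product c → product (padOnes c) ≡ sum (padOnes c)
padOnes-isProductSum {c} Σ≤Π = begin
  product (padOnes c)            ≡⟨ product-++-ones c (product c ∸ sum c) ⟩
  product c                      ≡⟨ sym (m+[n∸m]≡n Σ≤Π) ⟩
  sum c + (product c ∸ sum c)    ≡⟨ sym (sum-++-ones c (product c ∸ sum c)) ⟩
  sum (padOnes c)                ∎
  where open ≡-Reasoning

padOnes-++-ones : ∀ c r → product (c ++ replicate r 1) ≡ sum (c ++ replicate r 1) →
                  padOnes c ≡ c ++ replicate r 1
padOnes-++-ones c r Π≡Σ = cong (λ k → c ++ replicate k 1) excess
  where
  excess : product c ∸ sum c ≡ r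
  excess = begin
    product c ∸ sum c                        ≡⟨ cong (_∸ sum c) (sym (product-++-ones c r)) ⟩
    product (c ++ replicate r 1) ∸ sum c     ≡⟨ cong (_∸ sum c) Π≡Σ ⟩
    sum (c ++ replicate r 1) ∸ sum c         ≡⟨ cong (_∸ sum c) (sum-++-ones c r) ⟩
    sum c + r ∸ sum c                        ≡⟨ m+n∸m≡n (sum c) r ⟩
    r                                        ∎
    where open ≡-Reasoning

stripOnes : List ℕ → List ℕ
stripOnes (suc (suc x) ∷ xs) = suc (suc x) ∷ stripOnes xs
stripOnes _                  = []

stripOnes-++-ones : ∀ k → All (2 ≤_) c → stripOnes (c ++ replicate k 1) ≡ c
stripOnes-++-ones zero    []                    = refl
stripOnes-++-ones (suc k) []                    = refl
stripOnes-++-ones k       (s≤s (s≤s z≤n) ∷ c≥2) = cong (_ ∷_) (stripOnes-++-ones k c≥2)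

record Tracks (c : List ℕ) (p s i : ℕ) : Set where
  constructor tracking
  field
    p≡product : p ≡ product c
    s≡sum     : s ≡ sum c
    i≡length  : i ≡ length c

Tracks-[] : Tracks [] 1 0 0
Tracks-[] = tracking refl refl refl

Tracks-∷ʳ : ∀ x → Tracks c p s i → Tracks (c ++ [ x ]) (p * x) (s + x) (suc i)
Tracks-∷ʳ {c} x (tracking refl refl refl) =
  tracking (sym (product-∷ʳ c x)) (sym (sum-∷ʳ c x)) (trans (+-comm 1 (length c)) (sym (length-++ c)))

-- The test p' < s' + n - i' of the search, free of truncated subtraction.
Feasible : ℕ → List ℕ → Set
Feasible n c = product c + length c < sum c + n

passes⇔Feasible : Tracks c p s i → T (p <ᵇ (s + n) ∸ i) ⇔ Feasible n c
passes⇔Feasible {c} {n = n} (tracking refl refl refl) =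
  mk⇔ (Equivalence.to equiv ∘′ <ᵇ⇒< _ _) (<⇒<ᵇ ∘′ Equivalence.from equiv)
  where
  equiv : product c < (sum c + n) ∸ length c ⇔ Feasible n c
  equiv = m<o∸n⇔m+n<o (product c) (length c) (sum c + n)

Feasible-++⁻ʳ : 2 ≤ product c → All (2 ≤_) d → Feasible n (c ++ d) → Feasible n c
Feasible-++⁻ʳ {c} {d} {n} 2≤Π d≥2 feasible =
  +-cancelʳ-< (sum d) (product c + length c) (sum c + n) (begin-strict
    product c + length c + sum d              ≡⟨ xy∙z≈xz∙y (product c) (length c) (sum d) ⟩
    product c + sum d + length c              ≤⟨ +-monoˡ-≤ (length c) (+-sum≤*-product 2≤Π d≥2) ⟩
    product c * product d + length c          ≤⟨ +-monoʳ-≤ (product c * product d) (m≤m+n (length c) (length d)) ⟩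
    product c * product d + (length c + length d)
                                              ≡⟨ sym (cong₂ _+_ (product-++ c d) (length-++ c)) ⟩
    product (c ++ d) + length (c ++ d)        <⟨ feasible ⟩
    sum (c ++ d) + n                          ≡⟨ cong (_+ n) (sum-++ c d) ⟩
    sum c + sum d + n                         ≡⟨ xy∙z≈xz∙y (sum c) (sum d) n ⟩
    sum c + n + sum d                         ∎)
    where open ≤-Reasoning

-- The loop body of search (local to it there) for a' = a: search n (suc f) p s i c m is by definition
-- concatMap (branch n f p s i c) (range2 m).
branch : (n f p s i : ℕ) → List ℕ → ℕ → List Step
branch n f p s i c a =
  if (p * a) <ᵇ ((s + a + n) ∸ suc i)
  then step (c ++ [ a ]) (p * a) (s + a) (suc i) ∷ search n f (p * a) (s + a) (suc i) (c ++ [ a ]) a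
  else []

if-elim : ∀ {A : Set} (Q : A → Set) b {u v : A} → (T b → Q u) → (¬ T b → Q v) → Q (if b then u else v)
if-elim Q true  qu _  = qu _
if-elim Q false _  qv = qv λ ()

∈-range2⁻ : x ∈ range2 m → 2 ≤ x
∈-range2⁻ x∈ with ∈-applyUpTo⁻ (2 +_) x∈
... | _ , _ , refl = s≤s (s≤s z≤n)

∈-range2⁺ : 2 ≤ x → x ≤ m → x ∈ range2 m
∈-range2⁺ {suc (suc k)} {suc m} (s≤s (s≤s z≤n)) (s≤s k<m) = ∈-applyUpTo⁺ (2 +_) k<m

range2-unique : ∀ m → Unique (range2 m)
range2-unique m = Uniqueₚ.applyUpTo⁺₁ (2 +_) (m ∸ 1) (λ i<j _ → <⇒≢ (+-monoʳ-< 2 i<j))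

All-concatMap⁺ : ∀ {A B : Set} {P : B → Set} {g : A → List B} {xs} →
                 (∀ {x} → x ∈ xs → All P (g x)) → All P (concatMap g xs)
All-concatMap⁺ h = Allₚ.concat⁺ (Allₚ.map⁺ (All.tabulate h))

-- Soundness

record IsFeasibleStep (n : ℕ) (st : Step) : Set where
  constructor feasibleStep
  field
    cand≥2   : All (2 ≤_) (cand st)
    tracks   : Tracks (cand st) (p' st) (s' st) (i' st)
    feasible : Feasible n (cand st)

module _ {n : ℕ} where

  search-sound : ∀ f p s i c m → Tracks c p s i → All (2 ≤_) c →
                 All (IsFeasibleStep n) (search n f p s i c m)
  search-sound zero    p s i c m _ _   = []
  search-sound (suc f) p s i c m t c≥2 = All-concatMap⁺ branch-sound
    where
    branch-sound : x ∈ range2 m → All (IsFeasibleStep n) (branch n f p s i c x)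
    branch-sound {x} x∈ = if-elim (All (IsFeasibleStep n)) _
      (λ passes → feasibleStep cx≥2 t′ (Equivalence.to (passes⇔Feasible t′) passes)
                  ∷ search-sound f (p * x) (s + x) (suc i) (c ++ [ x ]) x t′ cx≥2)
      (λ _ → [])
      where
      t′ : Tracks (c ++ [ x ]) (p * x) (s + x) (suc i)
      t′ = Tracks-∷ʳ x t
      cx≥2 : All (2 ≤_) (c ++ [ x ])
      cx≥2 = Allₚ.++⁺ c≥2 (∈-range2⁻ {m = m} x∈ ∷ [])

module FeasibleStep {n : ℕ} {st : Step} (fs : IsFeasibleStep n st) where
  open IsFeasibleStep fs

  s'≤p' : s' st ≤ p' st
  s'≤p' with tracks
  ... | tracking refl refl refl = sum≤product cand≥2

  n'Of+s'≡p'+i' : n'Of st + s' st ≡ p' st + i' st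
  n'Of+s'≡p'+i' = m∸n+n≡m (≤-trans s'≤p' (m≤m+n (p' st) (i' st)))

  n'Of≡p'∸s'+i' : n'Of st ≡ (p' st ∸ s' st) + i' st
  n'Of≡p'∸s'+i' = +-∸-comm (i' st) s'≤p'

  i'≤n'Of : i' st ≤ n'Of st
  i'≤n'Of = subst (i' st ≤_) (sym n'Of≡p'∸s'+i') (m≤n+m (i' st) (p' st ∸ s' st))

  n'Of<n : n'Of st < n
  n'Of<n with tracks
  ... | tracking refl refl refl =
    +-cancelʳ-< (s' st) (n'Of st) n (subst₂ _<_ (sym n'Of+s'≡p'+i') (+-comm (s' st) n) feasible)

  solOf≡padOnes : solOf st ≡ padOnes (cand st)
  solOf≡padOnes with tracks
  ... | tracking refl refl refl =
    cong (λ k → cand st ++ replicate k 1) (trans (cong (_∸ i' st) n'Of≡p'∸s'+i') (m+n∸n≡m _ (i' st)))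

  length-solOf : length (solOf st) ≡ n'Of st
  length-solOf = begin
    length (cand st ++ replicate (n'Of st ∸ i' st) 1)   ≡⟨ length-++ (cand st) ⟩
    length (cand st) + length (replicate (n'Of st ∸ i' st) 1)
                                                       ≡⟨ cong (length (cand st) +_) (length-replicate (n'Of st ∸ i' st)) ⟩
    length (cand st) + (n'Of st ∸ i' st)                ≡⟨ cong (_+ (n'Of st ∸ i' st)) (sym (Tracks.i≡length tracks)) ⟩
    i' st + (n'Of st ∸ i' st)                           ≡⟨ m+[n∸m]≡n i'≤n'Of ⟩
    n'Of st                                            ∎
    where open ≡-Reasoning

  solOf-isProductSum : product (solOf st) ≡ sum (solOf st)
  solOf-isProductSum =
    subst (λ l → product l ≡ sum l) (sym solOf≡padOnes) (padOnes-isProductSum {cand st} (sum≤product cand≥2))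

  stripOnes-solOf : stripOnes (solOf st) ≡ cand st
  stripOnes-solOf = stripOnes-++-ones (n'Of st ∸ i' st) cand≥2

-- Distinctness

Extends : List ℕ → ℕ → Step → Set
Extends c x st = ∃ λ r → cand st ≡ c ++ x ∷ r

module _ {n : ℕ} where

  search-extends : ∀ f p s i c m → All (λ st → ∃ λ y → Extends c y st) (search n f p s i c m)
  branch-extends : ∀ f p s i c a → All (Extends c a) (branch n f p s i c a)

  search-extends zero    p s i c m = []
  search-extends (suc f) p s i c m =
    All-concatMap⁺ λ {a} (_ : a ∈ range2 m) → All.map (a ,_) (branch-extends f p s i c a)

  branch-extends f p s i c a = if-elim (All (Extends c a)) _
    (λ _ → ([] , refl)
           ∷ All.map (λ {st} → reassociate {st}) (search-extends f (p * a) (s + a) (suc i) (c ++ [ a ]) a))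
    (λ _ → [])
    where
    reassociate : ∀ {st} → ∃ (λ y → Extends (c ++ [ a ]) y st) → Extends c a st
    reassociate (y , r , eq) = y ∷ r , trans eq (++-assoc c [ a ] (y ∷ r))

extends-distinct : ∀ {c x a st st′} → x ≢ a → Extends c x st → Extends c a st′ → cand st ≢ cand st′
extends-distinct {c} x≢a (r , eq) (r′ , eq′) cands≡ =
  x≢a (∷-injectiveˡ (++-cancelˡ c _ _ (trans (sym eq) (trans cands≡ eq′))))

module _ {n : ℕ} where

  search-unique : ∀ f p s i c m → AllPairs (_≢_ on cand) (search n f p s i c m)
  branch-unique : ∀ f p s i c a → AllPairs (_≢_ on cand) (branch n f p s i c a)

  search-unique zero    p s i c m = []
  search-unique (suc f) p s i c m =
    AllPairsₚ.concat⁺ (Allₚ.map⁺ (All.universal (branch-unique f p s i c) (range2 m)))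
                      (AllPairsₚ.map⁺ (AllPairs.map across (range2-unique m)))
    where
    across : ∀ {x a} → x ≢ a →
             All (λ st → All (λ st′ → cand st ≢ cand st′) (branch n f p s i c a)) (branch n f p s i c x)
    across {x} {a} x≢a =
      All.map (λ {st} ext → All.map (λ {st′} ext′ → extends-distinct {st = st} {st′} x≢a ext ext′)
                                    (branch-extends f p s i c a))
              (branch-extends f p s i c x)

  branch-unique f p s i c a = if-elim (AllPairs (_≢_ on cand)) _
    (λ _ → All.map (λ {st} → longer {st}) (search-extends f (p * a) (s + a) (suc i) (c ++ [ a ]) a)
           ∷ search-unique f (p * a) (s + a) (suc i) (c ++ [ a ]) a)
    (λ _ → [])
    where
    longer : ∀ {st} → ∃ (λ y → Extends (c ++ [ a ]) y st) → c ++ [ a ] ≢ cand st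
    longer (y , r , eq) cands≡ with ++-identityʳ-unique (c ++ [ a ]) (trans cands≡ eq)
    ... | ()

-- Completeness

module _ {n : ℕ} where

  search-complete : ∀ f p s i c m {x d} → Tracks c p s i → All (2 ≤_) c → x ∈ range2 m →
                    All (2 ≤_) d → Linked _≥_ (x ∷ d) → length d < f → Feasible n (c ++ x ∷ d) →
                    ∃ λ st → st ∈ search n f p s i c m × cand st ≡ c ++ x ∷ d
  search-complete (suc f) p s i c m {x} {d} t c≥2 x∈ d≥2 x∷d↓ |d|<f feasible
    with if-elim (λ l → ∃ λ st → st ∈ l × cand st ≡ c ++ x ∷ d) _
                 (λ _ → in-search d≥2 x∷d↓ |d|<f feasible′) (λ fails → ⊥-elim (fails passes))
    where
    t′ : Tracks (c ++ [ x ]) (p * x) (s + x) (suc i)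
    t′ = Tracks-∷ʳ x t
    cx≥2 : All (2 ≤_) (c ++ [ x ])
    cx≥2 = Allₚ.++⁺ c≥2 (∈-range2⁻ {m = m} x∈ ∷ [])
    feasible′ : Feasible n ((c ++ [ x ]) ++ d)
    feasible′ = subst (Feasible n) (sym (++-assoc c [ x ] d)) feasible
    2≤Π : 2 ≤ product (c ++ [ x ])
    2≤Π = begin
      2                      ≤⟨ ∈-range2⁻ {m = m} x∈ ⟩
      x                      ≤⟨ m≤n+m x (sum c) ⟩
      sum c + x              ≡⟨ sym (sum-∷ʳ c x) ⟩
      sum (c ++ [ x ])       ≤⟨ sum≤product cx≥2 ⟩
      product (c ++ [ x ])   ∎
      where open ≤-Reasoning
    passes : T (p * x <ᵇ (s + x + n) ∸ suc i)
    passes = Equivalence.from (passes⇔Feasible t′) (Feasible-++⁻ʳ {c ++ [ x ]} 2≤Π d≥2 feasible′)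
    in-search : ∀ {d} → All (2 ≤_) d → Linked _≥_ (x ∷ d) → length d < suc f → Feasible n ((c ++ [ x ]) ++ d) →
                ∃ λ st → st ∈ step (c ++ [ x ]) (p * x) (s + x) (suc i)
                              ∷ search n f (p * x) (s + x) (suc i) (c ++ [ x ]) x
                       × cand st ≡ c ++ x ∷ d
    in-search [] _ _ _ = _ , here refl , refl
    in-search {y ∷ d} (2≤y ∷ d≥2) (y≤x ∷ y∷d↓) |y∷d|<1+f feasible″
      with search-complete f (p * x) (s + x) (suc i) (c ++ [ x ]) x t′ cx≥2 (∈-range2⁺ 2≤y y≤x) d≥2 y∷d↓
             (s≤s⁻¹ |y∷d|<1+f) feasible″
    ... | st , st∈ , eq = st , there st∈ , trans eq (++-assoc c [ x ] (y ∷ d))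
  ... | st , st∈ , eq = st , ∈-concatMap⁺ (branch n f p s i c) (lose x∈ st∈) , eq

Linked-++⁻ˡ : ∀ {A : Set} {R : A → A → Set} (xs : List A) {ys} → Linked R (xs ++ ys) → Linked R xs
Linked-++⁻ˡ []           _        = []
Linked-++⁻ˡ (x ∷ [])     _        = [-]
Linked-++⁻ˡ (x ∷ y ∷ xs) (r ∷ rs) = r ∷ Linked-++⁻ˡ (y ∷ xs) rs

ones-after-1 : All (1 ≤_) d → Linked _≥_ (1 ∷ d) → d ≡ replicate (length d) 1
ones-after-1 []          _           = refl
ones-after-1 (1≤y ∷ d≥1) (y≤1 ∷ 1∷d↓) with ≤-antisym y≤1 1≤y
... | refl = cong (1 ∷_) (ones-after-1 d≥1 1∷d↓)

split-ones : All (1 ≤_) d → Linked _≥_ d → ∃₂ λ b r → All (2 ≤_) b × d ≡ b ++ replicate r 1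
split-ones []                              _   = [] , 0 , [] , refl
split-ones {suc zero ∷ d}    (_ ∷ d≥1)     y∷d↓ = [] , suc (length d) , [] , cong (1 ∷_) (ones-after-1 d≥1 y∷d↓)
split-ones {suc (suc y) ∷ d} (_ ∷ d≥1)     y∷d↓ with split-ones d≥1 (Linked.tail y∷d↓)
... | b , r , b≥2 , refl = suc (suc y) ∷ b , r , s≤s (s≤s z≤n) ∷ b≥2 , refl

-- Bounds the first entry of a solution by n' < n, so that the loop a' = 2, …, n of the first call reaches it.
head≤length : ∀ {r} → All (2 ≤_) (x ∷ d) → product (x ∷ d) ≡ sum (x ∷ d) + r → 2 ≤ length (x ∷ d) + r →
              x ≤ length (x ∷ d) + r
head≤length {x} {[]} {r} _ Π≡Σ+r 2≤1+r with +-cancelˡ-≡ x 0 r (trans (+-identityʳ x) x≡x+r)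
  where
  x≡x+r : x ≡ x + r
  x≡x+r = trans (sym (*-identityʳ x)) (trans Π≡Σ+r (cong (_+ r) (+-identityʳ x)))
... | refl = ⊥-elim (<-irrefl refl 2≤1+r)
head≤length {x} {y ∷ d} {r} (2≤x ∷ y∷d≥2@(2≤y ∷ _)) Π≡Σ+r _ =
  ≤-trans x≤r+2 (subst (r + 2 ≤_) (+-comm r (2 + length d)) (+-monoʳ-≤ r (m≤m+n 2 (length d))))
  where
  open ≤-Reasoning
  Πd Σd : ℕ
  Πd = product (y ∷ d)
  Σd = sum (y ∷ d)
  2≤Πd : 2 ≤ Πd
  2≤Πd = ≤-trans 2≤y (≤-trans (m≤m+n y (sum d)) (sum≤product y∷d≥2))
  x≤r+2 : x ≤ r + 2
  x≤r+2 = +-cancelˡ-≤ (x + Σd) x (r + 2) (begin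
    x + Σd + x         ≡⟨ xy∙z≈xz∙y x Σd x ⟩
    x + x + Σd         ≤⟨ +-monoʳ-≤ (x + x) (sum≤product y∷d≥2) ⟩
    x + x + Πd         ≤⟨ m+m+n≤m*n+2 (≤-trans (s≤s z≤n) 2≤x) 2≤Πd ⟩
    x * Πd + 2         ≡⟨ cong (_+ 2) Π≡Σ+r ⟩
    x + Σd + r + 2     ≡⟨ +-assoc (x + Σd) r 2 ⟩
    x + Σd + (r + 2)   ∎)

feasibleSteps-complete : ∀ {n} n′ → 2 ≤ n′ → n′ < n → (a : List ℕ) → length a ≡ n′ →
                 All (1 ≤_) a → Linked _≥_ a → product a ≡ sum a →
                 Σ Step λ st → (st ∈ feasibleSteps n) × (solOf st ≡ a)
feasibleSteps-complete {n} _ 2≤n′ n′<n a refl a≥1 a↓ Π≡Σ with split-ones a≥1 a↓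
... | [] , r , [] , refl = ⊥-elim (<-irrefl 1≡r (subst (2 ≤_) (length-replicate r) 2≤n′))
  where
  1≡r : 1 ≡ r
  1≡r = trans (sym (product-++-ones [] r)) (trans Π≡Σ (sum-++-ones [] r))
... | b@(x ∷ d) , r , b≥2@(2≤x ∷ d≥2) , refl
  with search-complete n 1 0 0 [] n Tracks-[] [] (∈-range2⁺ 2≤x x≤n) d≥2 (Linked-++⁻ˡ b a↓) |d|<n feasible
  where
  Πb≡Σb+r : product b ≡ sum b + r
  Πb≡Σb+r = trans (sym (product-++-ones b r)) (trans Π≡Σ (sum-++-ones b r))
  |a| : length a ≡ length b + r
  |a| = trans (length-++ b) (cong (length b +_) (length-replicate r))
  x≤n : x ≤ n
  x≤n = ≤-trans (head≤length b≥2 Πb≡Σb+r (subst (2 ≤_) |a| 2≤n′)) (subst (_≤ n) |a| (<⇒≤ n′<n))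
  |d|<n : length d < n
  |d|<n = ≤-trans (s≤s (m≤m+n (length d) r)) (<⇒≤ (subst (_< n) |a| n′<n))
  feasible : Feasible n b
  feasible = begin-strict
    product b + length b     ≡⟨ cong (_+ length b) Πb≡Σb+r ⟩
    sum b + r + length b     ≡⟨ +-assoc (sum b) r (length b) ⟩
    sum b + (r + length b)   <⟨ +-monoʳ-< (sum b) (subst (_< n) (trans |a| (+-comm (length b) r)) n′<n) ⟩
    sum b + n                ∎
    where open ≤-Reasoning
... | st , st∈ , cand≡b = st , st∈ , (begin
  solOf st             ≡⟨ FeasibleStep.solOf≡padOnes (All.lookup (search-sound n 1 0 0 [] n Tracks-[] []) st∈) ⟩
  padOnes (cand st)    ≡⟨ cong padOnes cand≡b ⟩
  padOnes b            ≡⟨ padOnes-++-ones b r Π≡Σ ⟩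
  b ++ replicate r 1   ∎)
  where open ≡-Reasoning

theorem2p3 : (n : ℕ) → 3 ≤ n →
    ((st : Step) → st ∈ feasibleSteps n →
       ∃ λ (n' : ℕ) → (n' + s' st ≡ p' st + i' st) × (i' st ≤ n') × (n' < n)
         × (solOf st ≡ cand st ++ replicate (n' ∸ i' st) 1)
         × (length (solOf st) ≡ n') × (product (solOf st) ≡ sum (solOf st)))
    × ((n' : ℕ) → 2 ≤ n' → n' < n → (a : List ℕ) → length a ≡ n' →
       All (λ x → 1 ≤ x) a → Linked _≥_ a → product a ≡ sum a →
       Σ Step λ st → (st ∈ feasibleSteps n) × (solOf st ≡ a))
    × Unique (map solOf (feasibleSteps n))
theorem2p3 n _ =
  (λ st st∈ → let open FeasibleStep (All.lookup sound st∈) in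
     n'Of st , n'Of+s'≡p'+i' , i'≤n'Of , n'Of<n , refl , length-solOf , solOf-isProductSum) ,
  feasibleSteps-complete ,
  Uniqueₚ.map⁻ (subst Unique cands≡stripped cands-unique)
  where
  sound : All (IsFeasibleStep n) (feasibleSteps n)
  sound = search-sound n 1 0 0 [] n Tracks-[] []

  cands-unique : Unique (map cand (feasibleSteps n))
  cands-unique = AllPairsₚ.map⁺ (search-unique n 1 0 0 [] n)

  cands≡stripped : map cand (feasibleSteps n) ≡ map stripOnes (map solOf (feasibleSteps n))
  cands≡stripped = trans (map-cong-local (All.map (λ fs → sym (FeasibleStep.stripOnes-solOf fs)) sound))
                         (map-∘ (feasibleSteps n))
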